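{- Let $G=(V,E)$ be a basic graph. Then Breaker has a strategy to prevent Maker from claiming all three edges of any triangle in the unbiased Maker-Breaker game on $E(G)$.
   Context: For a graph $G$ without isolated vertices, let $T_G$ be the graph whose vertices are the triangles of $G$, two triangles adjacent in $T_G$ if they share an edge. $G$ is called very basic if $T_G$ is isomorphic to a subgraph of $K_3^+$ (a triangle with one pendant edge attached) or to a subgraph of a path $P_k$ for some $k\in\mathbb{N}$. $G$ is called basic if there are two distinct edges $e_1,e_2\in E(G)$ such that $G-e_i$ is very basic for both $i\in\{1,2\}$. In the unbiased Maker-Breaker game on $E(G)$, Maker and Breaker alternately claim one unclaimed edge each (Maker first), until all edges are claimed. -}

module Defs where

open import Data.Nat using (ℕ; zero; suc)
open import Data.Fin using (Fin; toℕ; _<_)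
open import Data.Fin.Properties using (_≟_; _<?_)
open import Data.Bool using (Bool; true; false; _∧_; not; T; if_then_else_; _∨_)
open import Data.List using (List; []; _∷_; concatMap)
open import Data.List.Membership.Propositional using (_∈_; _─_)
open import Data.List.Relation.Unary.All using (All)
open import Data.Product using (Σ; ∃; _×_; _,_)
open import Data.Sum using (_⊎_)
open import Data.Empty using (⊥)
open import Relation.Nullary using (¬_)
open import Relation.Nullary.Decidable using (⌊_⌋)
open import Relation.Binary.PropositionalEquality using (_≡_; _≢_; refl; trans; cong; cong₂)
open import Data.List using (allFin)

record Graph (n : ℕ) : Set where
  field
    adj     : Fin n → Fin n → Bool
    adj-sym : ∀ u v → adj u v ≡ adj v u
    adj-irr : ∀ v → adj v v ≡ false
open Graph public

Adj : ∀ {n} → Graph n → Fin n → Fin n → Set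
Adj G u v = T (adj G u v)

NoIsolatedVertices : ∀ {n} → Graph n → Set
NoIsolatedVertices {n} G = ∀ (v : Fin n) → ∃ λ u → Adj G v u

-- Edges are represented as ordered pairs (u , v) with u < v.
EdgeRep : ℕ → Set
EdgeRep n = Fin n × Fin n

IsEdge : ∀ {n} → Graph n → EdgeRep n → Set
IsEdge G (u , v) = (u < v) × Adj G u v

Edge : ∀ {n} → Graph n → Set
Edge {n} G = Σ (EdgeRep n) (IsEdge G)

edgeList : ∀ {n} → Graph n → List (EdgeRep n)
edgeList {n} G =
  concatMap (λ u → concatMap (λ v →
      if ⌊ u <? v ⌋ ∧ adj G u v then (u , v) ∷ [] else []) (allFin n))
    (allFin n)

sameEdge : ∀ {n} → EdgeRep n → Fin n → Fin n → Bool
sameEdge (u , v) x y =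
  (⌊ x ≟ u ⌋ ∧ ⌊ y ≟ v ⌋) ∨ (⌊ x ≟ v ⌋ ∧ ⌊ y ≟ u ⌋)

private
  ∧-comm' : ∀ a b → (a ∧ b) ≡ (b ∧ a)
  ∧-comm' true true = refl
  ∧-comm' true false = refl
  ∧-comm' false true = refl
  ∧-comm' false false = refl

  ∨-comm' : ∀ a b → (a ∨ b) ≡ (b ∨ a)
  ∨-comm' true true = refl
  ∨-comm' true false = refl
  ∨-comm' false true = refl
  ∨-comm' false false = refl

  sameEdge-sym : ∀ {n} (e : EdgeRep n) x y → sameEdge e x y ≡ sameEdge e y x
  sameEdge-sym (u , v) x y =
    trans (∨-comm' (⌊ x ≟ u ⌋ ∧ ⌊ y ≟ v ⌋) (⌊ x ≟ v ⌋ ∧ ⌊ y ≟ u ⌋))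
          (cong₂ _∨_ (∧-comm' ⌊ x ≟ v ⌋ ⌊ y ≟ u ⌋) (∧-comm' ⌊ x ≟ u ⌋ ⌊ y ≟ v ⌋))

delete : ∀ {n} → (G : Graph n) → EdgeRep n → Graph n
delete G e = record
  { adj = λ x y → adj G x y ∧ not (sameEdge e x y)
  ; adj-sym = λ x y → cong₂ (λ p q → p ∧ not q) (adj-sym G x y) (sameEdge-sym e x y)
  ; adj-irr = λ x → cong (λ p → p ∧ not (sameEdge e x x)) (adj-irr G x) }

record Triangle {n} (G : Graph n) : Set where
  constructor tri
  field
    a b c : Fin n
    a<b   : a < b
    b<c   : b < c
    ab    : Adj G a b
    bc    : Adj G b c
    ac    : Adj G a c
open Triangle public

_∈▵_ : ∀ {n} {G : Graph n} → Fin n → Triangle G → Set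
x ∈▵ t = (x ≡ a t) ⊎ (x ≡ b t) ⊎ (x ≡ c t)

SameTriangle : ∀ {n} {G : Graph n} → Triangle G → Triangle G → Set
SameTriangle t t' = (a t ≡ a t') × (b t ≡ b t') × (c t ≡ c t')

-- adjacency in T_G: distinct triangles sharing an edge
TAdj : ∀ {n} {G : Graph n} → Triangle G → Triangle G → Set
TAdj {n} t t' = ¬ SameTriangle t t' ×
  ∃ λ (x : Fin n) → ∃ λ (y : Fin n) →
    (x < y) × x ∈▵ t × y ∈▵ t × x ∈▵ t' × y ∈▵ t'

-- T_G is isomorphic to a subgraph of the graph H on Fin m with adjacency R,
-- i.e. there is an injective map V(T_G) → V(H) sending edges to edges.
TGEmbedsInto : ∀ {n} → Graph n → (m : ℕ) → (Fin m → Fin m → Set) → Set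
TGEmbedsInto G m R =
  Σ (Triangle G → Fin m) λ f →
    (∀ t t' → f t ≡ f t' → SameTriangle t t') ×
    (∀ t t' → TAdj t t' → R (f t) (f t'))

K3+Adj : Fin 4 → Fin 4 → Set
K3+Adj i j = Ed (toℕ i) (toℕ j) ⊎ Ed (toℕ j) (toℕ i)
  where
  Ed : ℕ → ℕ → Set
  Ed x y = ((x ≡ 0) × (y ≡ 1)) ⊎ ((x ≡ 0) × (y ≡ 2)) ⊎
           ((x ≡ 1) × (y ≡ 2)) ⊎ ((x ≡ 0) × (y ≡ 3))

PathAdj : (k : ℕ) → Fin k → Fin k → Set
PathAdj k i j = (suc (toℕ i) ≡ toℕ j) ⊎ (suc (toℕ j) ≡ toℕ i)

VeryBasic : ∀ {n} → Graph n → Set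
VeryBasic G = TGEmbedsInto G 4 K3+Adj ⊎ (∃ λ (k : ℕ) → TGEmbedsInto G k (PathAdj k))

Basic : ∀ {n} → Graph n → Set
Basic G = ∃ λ (e₁ : Edge G) → ∃ λ (e₂ : Edge G) →
  (Data.Product.proj₁ e₁ ≢ Data.Product.proj₁ e₂) ×
  VeryBasic (delete G (Data.Product.proj₁ e₁)) ×
  VeryBasic (delete G (Data.Product.proj₁ e₂))

MakerHasNoTriangle : ∀ {n} (G : Graph n) → List (EdgeRep n) → Set
MakerHasNoTriangle G M =
  (t : Triangle G) → ¬ (((a t , b t) ∈ M) × ((b t , c t) ∈ M) × ((a t , c t) ∈ M))

-- Breaker can force, from the position where Maker has claimed M and the
-- edges U are still unclaimed, that at the end of the game Maker has
-- claimed no triangle.  MakerTurn / BreakerTurn: whose move it is.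
-- (Since Maker's set only grows, "Maker never completes a triangle" is the
-- same as "Maker owns no triangle when all edges are claimed".)
mutual
  data BreakerWinsMakerTurn {n} (G : Graph n) :
      List (EdgeRep n) → List (EdgeRep n) → Set where
    mend  : ∀ {M} → MakerHasNoTriangle G M → BreakerWinsMakerTurn G M []
    mmove : ∀ {M x xs} →
            (∀ {e} (p : e ∈ (x ∷ xs)) →
               BreakerWinsBreakerTurn G (e ∷ M) ((x ∷ xs) ─ p)) →
            BreakerWinsMakerTurn G M (x ∷ xs)

  data BreakerWinsBreakerTurn {n} (G : Graph n) :
      List (EdgeRep n) → List (EdgeRep n) → Set where
    bend  : ∀ {M} → MakerHasNoTriangle G M → BreakerWinsBreakerTurn G M []
    bmove : ∀ {M x xs e} → (p : e ∈ (x ∷ xs)) →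
            BreakerWinsMakerTurn G M ((x ∷ xs) ─ p) →
            BreakerWinsBreakerTurn G M (x ∷ xs)

BreakerWinsTriangleGame : ∀ {n} → Graph n → Set
BreakerWinsTriangleGame G = BreakerWinsMakerTurn G [] (edgeList G)

module Submission where

-- Let e₁ ≠ e₂ be edges with G - eᵢ very basic.  Maker opens with an edge z;
-- Breaker answers with some eᵢ ≠ z and then plays a pairing strategy on
-- H = G - eᵢ: every triangle of H is assigned two of its edges, the pairs of
-- distinct triangles are disjoint and avoid z, and whenever Maker claims an
-- edge of a pair Breaker claims its partner.  Finally every triangle of G
-- contains eᵢ or a pair, so Breaker owns one of its edges.
--
-- The pairs come from a ranking ("key") of the triangles of H.  An edge is
-- lost for a triangle if it is z or lies in a triangle of smaller key.  If
-- triangles sharing an edge have different keys and no triangle has two lost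
-- edges, every triangle can pair two edges that are lost for no triangle, and
-- such edges belong to exactly one triangle.  Suitable keys exist when T_H is
-- a subgraph of a path (distance along the path from a triangle containing z)
-- and when T_H is a subgraph of K₃⁺ (a fixed ranking of the four positions,
-- validated on all 256 configurations by evaluation).

open import Data.Nat as ℕ using (ℕ; zero; suc; s≤s; z≤n; ∣_-_∣; _+_; _*_; _∸_)
open import Data.List using (List; []; _∷_; length; concatMap; allFin)
open import Data.List.Properties using (length-removeAt′)
open import Data.List.Membership.Propositional using (_∈_; _∉_; _─_)
open import Data.List.Membership.Propositional.Properties
  using (∈-concatMap⁺; ∈-concatMap⁻; ∈-allFin)
open import Data.List.Relation.Unary.Any as Any using (here; there; index)
open import Data.List.Relation.Unary.All using ([])
open import Data.List.Relation.Unary.All.Properties using (─⁺; All¬⇒¬Any)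
open import Data.List.Relation.Unary.AllPairs using ([]; _∷_)
open import Data.List.Relation.Unary.Unique.Propositional using (Unique)
open import Data.List.Relation.Unary.Unique.Propositional.Properties using (++⁺; allFin⁺)
import Data.Nat.Properties as ℕP
open import Data.Fin as Fin using (Fin; toℕ; _<_; _≤_)
open import Data.Fin.Properties
  using ( _≟_; _<?_; <-irrelevant; <-irrefl; <-asym; <-trans; ≤-refl; <⇒≢; <-cmp; any?; all?
        ; toℕ-injective)
open import Data.Bool using (Bool; true; false; T; _∧_; _∨_; not; if_then_else_)
open import Data.Bool.Properties using (T-irrelevant; T-∧)
open import Data.Unit using (tt)
open import Function.Bundles using (Equivalence)
open import Data.Product using (Σ; ∃; _×_; _,_; proj₁; proj₂)
open import Data.Product.Properties using (≡-dec)
open import Data.Sum using (_⊎_; inj₁; inj₂; [_,_]′)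
open import Data.Empty using (⊥; ⊥-elim)
open import Relation.Nullary using (¬_; Dec; yes; no)
open import Relation.Nullary.Decidable
  using (T?; _×-dec_; _⊎-dec_; _→-dec_; ¬?; ⌊_⌋; map′; toWitness; fromWitness)
open import Relation.Binary using (tri<; tri≈; tri>)
open import Relation.Binary.PropositionalEquality using (_≡_; _≢_; refl; sym; trans; cong; subst)
open import Defs

_≟E_ : ∀ {n} (x y : EdgeRep n) → Dec (x ≡ y)
_≟E_ = ≡-dec _≟_ _≟_

module Triangles {n : ℕ} (H : Graph n) where

  a<c : (t : Triangle H) → a t < c t
  a<c t = <-trans (a<b t) (b<c t)

  SameTriangle-sym : ∀ {t t' : Triangle H} → SameTriangle t t' → SameTriangle t' t
  SameTriangle-sym (p , q , r) = sym p , sym q , sym r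

  -- The proofs stored in a triangle are irrelevant, so a triangle is
  -- determined by its vertices.
  same⇒≡ : ∀ {t t' : Triangle H} → SameTriangle t t' → t ≡ t'
  same⇒≡ {tri x y z p q r s u} {tri .x .y .z p' q' r' s' u'} (refl , refl , refl)
    rewrite <-irrelevant p p' | <-irrelevant q q'
          | T-irrelevant r r' | T-irrelevant s s' | T-irrelevant u u' = refl

  SameTriangle? : (t t' : Triangle H) → Dec (SameTriangle t t')
  SameTriangle? t t' = (a t ≟ a t') ×-dec (b t ≟ b t') ×-dec (c t ≟ c t')

  anyTriangle? : (P : Triangle H → Set) → (∀ t → Dec (P t)) → Dec (∃ P)
  anyTriangle? P P? with any? (λ x → any? (λ y → any? (λ z → atVertices? x y z)))
    where
    AtVertices : Fin n → Fin n → Fin n → Set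
    AtVertices x y z = Σ (x < y) λ xy → Σ (y < z) λ yz →
      Σ (Adj H x y) λ axy → Σ (Adj H y z) λ ayz → Σ (Adj H x z) λ axz →
      P (tri x y z xy yz axy ayz axz)
    atVertices? : ∀ x y z → Dec (AtVertices x y z)
    atVertices? x y z
      with x <? y | y <? z | T? (adj H x y) | T? (adj H y z) | T? (adj H x z)
    ... | no ¬p | _ | _ | _ | _ = no λ q → ¬p (proj₁ q)
    ... | yes _ | no ¬p | _ | _ | _ = no λ q → ¬p (proj₁ (proj₂ q))
    ... | yes _ | yes _ | no ¬p | _ | _ = no λ q → ¬p (proj₁ (proj₂ (proj₂ q)))
    ... | yes _ | yes _ | yes _ | no ¬p | _ = no λ q → ¬p (proj₁ (proj₂ (proj₂ (proj₂ q))))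
    ... | yes _ | yes _ | yes _ | yes _ | no ¬p =
      no λ q → ¬p (proj₁ (proj₂ (proj₂ (proj₂ (proj₂ q)))))
    ... | yes xy | yes yz | yes axy | yes ayz | yes axz with P? (tri x y z xy yz axy ayz axz)
    ...   | yes pt = yes (xy , yz , axy , ayz , axz , pt)
    ...   | no ¬pt =
      no λ { (_ , _ , _ , _ , _ , pt) → ¬pt (subst P (same⇒≡ (refl , refl , refl)) pt) }
  ... | yes (_ , _ , _ , _ , _ , _ , _ , _ , pt) = yes (_ , pt)
  ... | no ¬w = no λ { (t , pt) → ¬w (a t , b t , c t , a<b t , b<c t , ab t , bc t , ac t , pt) }

  EdgeOf : Triangle H → EdgeRep n → Set
  EdgeOf t y = y ≡ (a t , b t) ⊎ y ≡ (b t , c t) ⊎ y ≡ (a t , c t)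

  EdgeOf? : ∀ t y → Dec (EdgeOf t y)
  EdgeOf? t y = (y ≟E (a t , b t)) ⊎-dec (y ≟E (b t , c t)) ⊎-dec (y ≟E (a t , c t))

  edge-ends : ∀ {t : Triangle H} {y} → EdgeOf t y →
              (proj₁ y ∈▵ t) × (proj₂ y ∈▵ t) × (proj₁ y < proj₂ y)
  edge-ends {t} (inj₁ refl) = inj₁ refl , inj₂ (inj₁ refl) , a<b t
  edge-ends {t} (inj₂ (inj₁ refl)) = inj₂ (inj₁ refl) , inj₂ (inj₂ refl) , b<c t
  edge-ends {t} (inj₂ (inj₂ refl)) = inj₁ refl , inj₂ (inj₂ refl) , a<c t

  vertices⇒edge : ∀ {t : Triangle H} {u v} → u ∈▵ t → v ∈▵ t → u < v → EdgeOf t (u , v)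
  vertices⇒edge (inj₁ refl) (inj₂ (inj₁ refl)) _ = inj₁ refl
  vertices⇒edge (inj₁ refl) (inj₂ (inj₂ refl)) _ = inj₂ (inj₂ refl)
  vertices⇒edge (inj₂ (inj₁ refl)) (inj₂ (inj₂ refl)) _ = inj₂ (inj₁ refl)
  vertices⇒edge (inj₁ refl) (inj₁ refl) u<u = ⊥-elim (<-irrefl refl u<u)
  vertices⇒edge (inj₂ (inj₁ refl)) (inj₂ (inj₁ refl)) u<u = ⊥-elim (<-irrefl refl u<u)
  vertices⇒edge (inj₂ (inj₂ refl)) (inj₂ (inj₂ refl)) u<u = ⊥-elim (<-irrefl refl u<u)
  vertices⇒edge {t} (inj₂ (inj₁ refl)) (inj₁ refl) b<a = ⊥-elim (<-asym b<a (a<b t))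
  vertices⇒edge {t} (inj₂ (inj₂ refl)) (inj₁ refl) c<a = ⊥-elim (<-asym c<a (a<c t))
  vertices⇒edge {t} (inj₂ (inj₂ refl)) (inj₂ (inj₁ refl)) c<b = ⊥-elim (<-asym c<b (b<c t))

  a-≤ : ∀ {t : Triangle H} {x} → x ∈▵ t → a t ≤ x
  a-≤ (inj₁ refl) = ≤-refl
  a-≤ {t} (inj₂ (inj₁ refl)) = ℕP.<⇒≤ (a<b t)
  a-≤ {t} (inj₂ (inj₂ refl)) = ℕP.<⇒≤ (a<c t)

  ≤-c : ∀ {t : Triangle H} {x} → x ∈▵ t → x ≤ c t
  ≤-c {t} (inj₁ refl) = ℕP.<⇒≤ (a<c t)
  ≤-c {t} (inj₂ (inj₁ refl)) = ℕP.<⇒≤ (b<c t)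
  ≤-c (inj₂ (inj₂ refl)) = ≤-refl

  below-b : ∀ {t : Triangle H} {x} → x ∈▵ t → x < b t → x ≡ a t
  below-b (inj₁ eq) _ = eq
  below-b (inj₂ (inj₁ eq)) x<b = ⊥-elim (<-irrefl eq x<b)
  below-b {t} (inj₂ (inj₂ refl)) c<b = ⊥-elim (<-asym c<b (b<c t))

  above-b : ∀ {t : Triangle H} {x} → x ∈▵ t → b t < x → x ≡ c t
  above-b {t} (inj₁ refl) b<a = ⊥-elim (<-asym b<a (a<b t))
  above-b (inj₂ (inj₁ eq)) b<x = ⊥-elim (<-irrefl (sym eq) b<x)
  above-b (inj₂ (inj₂ eq)) _ = eq

  vertices⇒same : ∀ {t t' : Triangle H} → a t ∈▵ t' → b t ∈▵ t' → c t ∈▵ t' → SameTriangle t t'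
  vertices⇒same {t} {t'} ma mb mc = a≡ ma , b≡ mb , c≡ mc
    where
    a≡ : a t ∈▵ t' → a t ≡ a t'
    a≡ (inj₁ eq) = eq
    a≡ (inj₂ (inj₁ eq)) = ⊥-elim (<-irrefl (trans (above-b {t'} mb (above eq (a<b t)))
                                                  (sym (above-b {t'} mc (above eq (a<c t)))))
                                           (b<c t))
      where
      above : ∀ {x} → a t ≡ b t' → a t < x → b t' < x
      above refl lt = lt
    a≡ (inj₂ (inj₂ eq)) = ⊥-elim (<-irrefl eq (ℕP.<-≤-trans (a<b t) (≤-c {t'} mb)))
    c≡ : c t ∈▵ t' → c t ≡ c t'
    c≡ (inj₂ (inj₂ eq)) = eq
    c≡ (inj₂ (inj₁ eq)) = ⊥-elim (<-irrefl (trans (below-b {t'} ma (below eq (a<c t)))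
                                                  (sym (below-b {t'} mb (below eq (b<c t)))))
                                           (a<b t))
      where
      below : ∀ {x} → c t ≡ b t' → x < c t → x < b t'
      below refl lt = lt
    c≡ (inj₁ eq) = ⊥-elim (<-irrefl (sym eq) (ℕP.≤-<-trans (a-≤ {t'} mb) (b<c t)))
    b≡ : b t ∈▵ t' → b t ≡ b t'
    b≡ (inj₂ (inj₁ eq)) = eq
    b≡ (inj₁ eq) = ⊥-elim (<-irrefl (trans (a≡ ma) (sym eq)) (a<b t))
    b≡ (inj₂ (inj₂ eq)) = ⊥-elim (<-irrefl (trans eq (sym (c≡ mc))) (b<c t))

  ab≢bc : (t : Triangle H) → (a t , b t) ≢ (b t , c t)
  ab≢bc t eq = <-irrefl (cong proj₁ eq) (a<b t)

  ab≢ac : (t : Triangle H) → (a t , b t) ≢ (a t , c t)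
  ab≢ac t eq = <-irrefl (cong proj₂ eq) (b<c t)

  bc≢ac : (t : Triangle H) → (b t , c t) ≢ (a t , c t)
  bc≢ac t eq = <-irrefl (cong proj₁ (sym eq)) (a<b t)

  -- Two triangles sharing two distinct edges coincide: the two edges already
  -- cover all three vertices.
  two-edges⇒same : ∀ {t t' : Triangle H} {y₁ y₂} → EdgeOf t y₁ → EdgeOf t y₂ → y₁ ≢ y₂ →
                   EdgeOf t' y₁ → EdgeOf t' y₂ → SameTriangle t t'
  two-edges⇒same {t} {t'} e₁ e₂ y₁≢y₂ f₁ f₂ with edge-ends {t'} f₁ | edge-ends {t'} f₂
  two-edges⇒same (inj₁ refl) (inj₁ refl) y₁≢y₂ _ _ | _ | _ = ⊥-elim (y₁≢y₂ refl)
  two-edges⇒same (inj₂ (inj₁ refl)) (inj₂ (inj₁ refl)) y₁≢y₂ _ _ | _ | _ = ⊥-elim (y₁≢y₂ refl)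
  two-edges⇒same (inj₂ (inj₂ refl)) (inj₂ (inj₂ refl)) y₁≢y₂ _ _ | _ | _ = ⊥-elim (y₁≢y₂ refl)
  two-edges⇒same {t} {t'} (inj₁ refl) (inj₂ (inj₁ refl)) _ _ _ | u₁ , v₁ , _ | _ , v₂ , _ =
    vertices⇒same {t} {t'} u₁ v₁ v₂
  two-edges⇒same {t} {t'} (inj₁ refl) (inj₂ (inj₂ refl)) _ _ _ | u₁ , v₁ , _ | _ , v₂ , _ =
    vertices⇒same {t} {t'} u₁ v₁ v₂
  two-edges⇒same {t} {t'} (inj₂ (inj₁ refl)) (inj₁ refl) _ _ _ | _ , v₁ , _ | u₂ , v₂ , _ =
    vertices⇒same {t} {t'} u₂ v₂ v₁
  two-edges⇒same {t} {t'} (inj₂ (inj₁ refl)) (inj₂ (inj₂ refl)) _ _ _ | u₁ , v₁ , _ | u₂ , _ , _ =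
    vertices⇒same {t} {t'} u₂ u₁ v₁
  two-edges⇒same {t} {t'} (inj₂ (inj₂ refl)) (inj₁ refl) _ _ _ | u₁ , v₁ , _ | _ , v₂ , _ =
    vertices⇒same {t} {t'} u₁ v₂ v₁
  two-edges⇒same {t} {t'} (inj₂ (inj₂ refl)) (inj₂ (inj₁ refl)) _ _ _ | u₁ , v₁ , _ | u₂ , _ , _ =
    vertices⇒same {t} {t'} u₁ u₂ v₁

  record Neighbours (t t' : Triangle H) : Set where
    constructor neighbours
    field
      distinct : ¬ SameTriangle t t'
      shared : ∃ λ y → EdgeOf t y × EdgeOf t' y

  Neighbours⇒TAdj : ∀ {t t' : Triangle H} → Neighbours t t' → TAdj t t'
  Neighbours⇒TAdj {t} {t'} (neighbours t≢t' (_ , e , e')) with edge-ends {t} e | edge-ends {t'} e'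
  ... | u , v , u<v | u' , v' , _ = t≢t' , _ , _ , u<v , u , v , u' , v'

  Neighbours-sym : ∀ {t t' : Triangle H} → Neighbours t t' → Neighbours t' t
  Neighbours-sym {t} {t'} (neighbours t≢t' (y , e , e')) =
    neighbours (λ s → t≢t' (SameTriangle-sym {t'} {t} s)) (y , e' , e)

  Neighbours? : ∀ t t' → Dec (Neighbours t t')
  Neighbours? t t'
    with SameTriangle? t t' | EdgeOf? t' (a t , b t) | EdgeOf? t' (b t , c t) | EdgeOf? t' (a t , c t)
  ... | yes same | _ | _ | _ = no λ nb → Neighbours.distinct nb same
  ... | no t≢t' | yes e | _ | _ = yes (neighbours t≢t' (_ , inj₁ refl , e))
  ... | no t≢t' | no _ | yes e | _ = yes (neighbours t≢t' (_ , inj₂ (inj₁ refl) , e))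
  ... | no t≢t' | no _ | no _ | yes e = yes (neighbours t≢t' (_ , inj₂ (inj₂ refl) , e))
  ... | no _ | no ¬ab | no ¬bc | no ¬ac =
    no λ { (neighbours _ (_ , inj₁ refl , e)) → ¬ab e
         ; (neighbours _ (_ , inj₂ (inj₁ refl) , e)) → ¬bc e
         ; (neighbours _ (_ , inj₂ (inj₂ refl) , e)) → ¬ac e }

module _ {A : Set} where

  ∈-─⁻ : ∀ {y z : A} {xs} (p : z ∈ xs) → y ∈ xs ─ p → y ∈ xs
  ∈-─⁻ (here _) m = there m
  ∈-─⁻ (there p) (here eq) = here eq
  ∈-─⁻ (there p) (there m) = there (∈-─⁻ p m)

  ∈-─⁺ : ∀ {y z : A} {xs} (p : z ∈ xs) → y ∈ xs → y ≢ z → y ∈ xs ─ p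
  ∈-─⁺ (here refl) (here refl) y≢z = ⊥-elim (y≢z refl)
  ∈-─⁺ (here _) (there m) _ = m
  ∈-─⁺ (there p) (here eq) _ = here eq
  ∈-─⁺ (there p) (there m) y≢z = there (∈-─⁺ p m y≢z)

  Unique-─ : ∀ {z : A} {xs} (p : z ∈ xs) → Unique xs → Unique (xs ─ p)
  Unique-─ (here _) (_ ∷ u) = u
  Unique-─ (there p) (x≢ ∷ u) = ─⁺ p x≢ ∷ Unique-─ p u

  ∉-─ : ∀ {z : A} {xs} (p : z ∈ xs) → Unique xs → z ∉ xs ─ p
  ∉-─ (here refl) (z≢ ∷ _) m = All¬⇒¬Any z≢ m
  ∉-─ (there p) (x≢ ∷ _) (here refl) = All¬⇒¬Any x≢ p
  ∉-─ (there p) (_ ∷ u) (there m) = ∉-─ p u m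

  ─-shorter : ∀ {z : A} {xs} (p : z ∈ xs) → length (xs ─ p) ℕ.< length xs
  ─-shorter {xs = xs} p = ℕP.≤-reflexive (sym (length-removeAt′ xs (index p)))

Unique-concatMap : ∀ {A B : Set} (f : A → List B) {xs} → Unique xs → (∀ x → Unique (f x)) →
                   (∀ {x x' y} → y ∈ f x → y ∈ f x' → x ≡ x') → Unique (concatMap f xs)
Unique-concatMap f {[]} _ _ _ = []
Unique-concatMap f {x ∷ xs} (x∉xs ∷ u) pieces disjoint =
  ++⁺ (pieces x) (Unique-concatMap f u pieces disjoint)
      (λ { (m , m') → All¬⇒¬Any x∉xs (Any.map (disjoint m) (∈-concatMap⁻ f {xs = xs} m')) })

-- Breaker already owns the edge e, and Paired is a
-- set of disjoint pairs of edges (a symmetric, functional, irreflexive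
-- relation).  If every Maker set that avoids e and contains no whole pair is
-- triangle-free, then Breaker wins from every position in which each pair is
-- untouched or already broken by Breaker: he answers an edge of a pair with
-- its partner, and otherwise claims an arbitrary free edge.
module PairingStrategy {n : ℕ} (G : Graph n) (e : EdgeRep n)
  (Paired : EdgeRep n → EdgeRep n → Set)
  (Paired-sym : ∀ {p q} → Paired p q → Paired q p)
  (Paired-functional : ∀ {p q q'} → Paired p q → Paired p q' → q ≡ q')
  (Paired-irreflexive : ∀ {p q} → Paired p q → p ≢ q)
  (partner? : ∀ p → Dec (∃ (Paired p)))
  (sufficient : ∀ M → e ∉ M → (∀ p q → Paired p q → p ∉ M ⊎ q ∉ M) → MakerHasNoTriangle G M)
  where

  open import Data.List.Membership.DecPropositional (_≟E_ {n}) using (_∈?_)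

  Edges : Set
  Edges = List (EdgeRep n)

  -- Given Maker's edges M and the free edges U, Breaker owns the others.
  Breakers : Edges → Edges → EdgeRep n → Set
  Breakers M U p = p ∉ M × p ∉ U

  Safe : Edges → Edges → EdgeRep n → EdgeRep n → Set
  Safe M U p q = (p ∈ U × q ∈ U) ⊎ Breakers M U p ⊎ Breakers M U q

  -- Right after Maker claimed z, a pair may also be threatened: z and a
  -- free partner.
  Threatened : EdgeRep n → Edges → EdgeRep n → EdgeRep n → Set
  Threatened z U p q = (p ≡ z × q ∈ U) ⊎ (q ≡ z × p ∈ U)

  record Position (M U : Edges) : Set where
    field
      free-unique : Unique U
      free-unclaimed : ∀ {y} → y ∈ U → y ∉ M
      e-owned : Breakers M U e
      pairs-safe : ∀ p q → Paired p q → Safe M U p q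

  record PositionAfter (z : EdgeRep n) (M U : Edges) : Set where
    field
      free-unique : Unique U
      free-unclaimed : ∀ {y} → y ∈ U → y ∉ M
      e-owned : Breakers M U e
      pairs-safe : ∀ p q → Paired p q → Safe M U p q ⊎ Threatened z U p q

  -- When no edge is free every pair is broken, so Maker has no triangle.
  final : ∀ {M} → Position M [] → MakerHasNoTriangle G M
  final {M} pos = sufficient M (proj₁ e-owned) broken
    where
    open Position pos
    broken : ∀ p q → Paired p q → p ∉ M ⊎ q ∉ M
    broken p q pq with pairs-safe p q pq
    ... | inj₂ (inj₁ (p∉M , _)) = inj₁ p∉M
    ... | inj₂ (inj₂ (q∉M , _)) = inj₂ q∉M

  -- Likewise right after Maker's move, where a threatened pair would need a
  -- free edge.
  final-after : ∀ {z M} → PositionAfter z M [] → MakerHasNoTriangle G M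
  final-after {z} {M} pos = final record
    { free-unique = free-unique ; free-unclaimed = λ () ; e-owned = e-owned ; pairs-safe = safe }
    where
    open PositionAfter pos
    safe : ∀ p q → Paired p q → Safe M [] p q
    safe p q pq with pairs-safe p q pq
    ... | inj₁ s = s
    ... | inj₂ (inj₁ (_ , ()))
    ... | inj₂ (inj₂ (_ , ()))

  maker-claims : ∀ {M U z} (z∈U : z ∈ U) → Position M U → PositionAfter z (z ∷ M) (U ─ z∈U)
  maker-claims {M} {U} {z} z∈U pos = record
    { free-unique = Unique-─ z∈U free-unique
    ; free-unclaimed = λ m → unclaimed (∈-─⁻ z∈U m) (λ { refl → ∉-─ z∈U free-unique m })
    ; e-owned = still-owned e-owned
    ; pairs-safe = safe }
    where
    open Position pos
    unclaimed : ∀ {y} → y ∈ U → y ≢ z → y ∉ z ∷ M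
    unclaimed _ y≢z (here eq) = y≢z eq
    unclaimed m _ (there m') = free-unclaimed m m'
    still-owned : ∀ {p} → Breakers M U p → Breakers (z ∷ M) (U ─ z∈U) p
    still-owned (p∉M , p∉U) = (λ { (here refl) → p∉U z∈U ; (there m) → p∉M m }) ,
                              (λ m → p∉U (∈-─⁻ z∈U m))
    safe : ∀ p q → Paired p q → Safe (z ∷ M) (U ─ z∈U) p q ⊎ Threatened z (U ─ z∈U) p q
    safe p q pq with pairs-safe p q pq
    ... | inj₂ (inj₁ owned) = inj₁ (inj₂ (inj₁ (still-owned owned)))
    ... | inj₂ (inj₂ owned) = inj₁ (inj₂ (inj₂ (still-owned owned)))
    ... | inj₁ (p∈U , q∈U) with p ≟E z | q ≟E z
    ...   | yes refl | yes refl = ⊥-elim (Paired-irreflexive pq refl)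
    ...   | yes refl | no q≢z = inj₂ (inj₁ (refl , ∈-─⁺ z∈U q∈U q≢z))
    ...   | no p≢z | yes refl = inj₂ (inj₂ (refl , ∈-─⁺ z∈U p∈U p≢z))
    ...   | no p≢z | no q≢z = inj₁ (inj₁ (∈-─⁺ z∈U p∈U p≢z , ∈-─⁺ z∈U q∈U q≢z))

  reply : ∀ z y ys → Σ (EdgeRep n) λ w → w ∈ y ∷ ys × (∀ q → Paired z q → q ∈ y ∷ ys → w ≡ q)
  reply z y ys with partner? z
  ... | no ¬partner = y , here refl , λ q pq _ → ⊥-elim (¬partner (q , pq))
  ... | yes (q' , pq') with q' ∈? (y ∷ ys)
  ...   | yes q'∈U = q' , q'∈U , λ q pq _ → Paired-functional pq' pq
  ...   | no q'∉U = y , here refl , λ q pq q∈U →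
    ⊥-elim (q'∉U (subst (_∈ y ∷ ys) (Paired-functional pq pq') q∈U))

  breaker-claims : ∀ {M U z w} (w∈U : w ∈ U) → (∀ q → Paired z q → q ∈ U → w ≡ q) →
                   PositionAfter z M U → Position M (U ─ w∈U)
  breaker-claims {M} {U} {z} {w} w∈U w-partner pos = record
    { free-unique = Unique-─ w∈U free-unique
    ; free-unclaimed = λ m → free-unclaimed (∈-─⁻ w∈U m)
    ; e-owned = still-owned e-owned
    ; pairs-safe = safe }
    where
    open PositionAfter pos
    still-owned : ∀ {p} → Breakers M U p → Breakers M (U ─ w∈U) p
    still-owned (p∉M , p∉U) = p∉M , λ m → p∉U (∈-─⁻ w∈U m)
    claimed : ∀ {p} → p ∈ U → w ≡ p → Breakers M (U ─ w∈U) p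
    claimed p∈U refl = free-unclaimed p∈U , ∉-─ w∈U free-unique
    safe : ∀ p q → Paired p q → Safe M (U ─ w∈U) p q
    safe p q pq with pairs-safe p q pq
    ... | inj₁ (inj₂ (inj₁ owned)) = inj₂ (inj₁ (still-owned owned))
    ... | inj₁ (inj₂ (inj₂ owned)) = inj₂ (inj₂ (still-owned owned))
    ... | inj₂ (inj₁ (refl , q∈U)) = inj₂ (inj₂ (claimed q∈U (w-partner q pq q∈U)))
    ... | inj₂ (inj₂ (refl , p∈U)) = inj₂ (inj₁ (claimed p∈U (w-partner p (Paired-sym pq) p∈U)))
    ... | inj₁ (inj₁ (p∈U , q∈U)) with w ≟E p | w ≟E q
    ...   | yes w≡p | _ = inj₂ (inj₁ (claimed p∈U w≡p))
    ...   | no _ | yes w≡q = inj₂ (inj₂ (claimed q∈U w≡q))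
    ...   | no w≢p | no w≢q =
      inj₁ (∈-─⁺ w∈U p∈U (λ p≡w → w≢p (sym p≡w)) , ∈-─⁺ w∈U q∈U (λ q≡w → w≢q (sym q≡w)))

  mutual
    maker-to-move : ∀ k {M U} → length U ℕ.≤ k → Position M U → BreakerWinsMakerTurn G M U
    maker-to-move k {U = []} _ pos = mend (final pos)
    maker-to-move (suc k) {U = _ ∷ _} |U|≤ pos =
      mmove λ z∈U → breaker-to-move k (ℕP.≤-pred (ℕP.<-≤-trans (─-shorter z∈U) |U|≤))
                                      (maker-claims z∈U pos)

    breaker-to-move : ∀ k {M U z} → length U ℕ.≤ k → PositionAfter z M U →
                      BreakerWinsBreakerTurn G M U
    breaker-to-move k {U = []} _ pos = bend (final-after pos)
    breaker-to-move k {U = y ∷ ys} {z = z} |U|≤ pos with reply z y ys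
    ... | w , w∈U , w-partner =
      bmove w∈U (maker-to-move k (ℕP.≤-trans (ℕP.<⇒≤ (─-shorter w∈U)) |U|≤)
                                 (breaker-claims w∈U w-partner pos))

  breaker-wins : ∀ {M U} → Position M U → BreakerWinsMakerTurn G M U
  breaker-wins {U = U} = maker-to-move (length U) ℕP.≤-refl

-- Fix an edge x (Maker's first edge)
-- and a key on the triangles of H.
module KeyPairing {n : ℕ} (H : Graph n) (x : EdgeRep n) (key : Triangle H → ℕ) where
  open Triangles H

  SmallerVia : Triangle H → EdgeRep n → Triangle H → Set
  SmallerVia t y t' = ¬ SameTriangle t t' × EdgeOf t' y × key t' ℕ.< key t

  Lost : Triangle H → EdgeRep n → Set
  Lost t y = y ≡ x ⊎ ∃ (SmallerVia t y)

  Lost? : ∀ t y → Dec (Lost t y)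
  Lost? t y = (y ≟E x) ⊎-dec anyTriangle? _ λ t' →
    ¬? (SameTriangle? t t') ×-dec EdgeOf? t' y ×-dec (key t' ℕ.<? key t)

  smaller⇒neighbours : ∀ {t t' y} → EdgeOf t y → SmallerVia t y t' → Neighbours t t'
  smaller⇒neighbours e (t≢t' , e' , _) = neighbours t≢t' (_ , e , e')

  record Admissible : Set where
    field
      separates : ∀ {t t' y} → ¬ SameTriangle t t' → EdgeOf t y → EdgeOf t' y → key t ≢ key t'
      one-lost : ∀ {t y₁ y₂} → EdgeOf t y₁ → EdgeOf t y₂ → Lost t y₁ → Lost t y₂ → y₁ ≡ y₂

  -- To see that no triangle has two lost edges it suffices to exclude x
  -- together with an edge shared with a smaller triangle, and two edges
  -- shared with two distinct smaller triangles; if the smaller triangles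
  -- coincide they share two edges with t.
  one-lost-criterion :
    (∀ {t t' y} → EdgeOf t x → EdgeOf t y → y ≢ x → SmallerVia t y t' → ⊥) →
    (∀ {t t₁ t₂ y₁ y₂} → EdgeOf t y₁ → EdgeOf t y₂ → y₁ ≢ y₂ → ¬ SameTriangle t₁ t₂ →
       SmallerVia t y₁ t₁ → SmallerVia t y₂ t₂ → ⊥) →
    ∀ {t y₁ y₂} → EdgeOf t y₁ → EdgeOf t y₂ → Lost t y₁ → Lost t y₂ → y₁ ≡ y₂
  one-lost-criterion x-alone distinct-smaller {t} {y₁} {y₂} e₁ e₂ l₁ l₂ with y₁ ≟E y₂
  ... | yes y₁≡y₂ = y₁≡y₂
  ... | no y₁≢y₂ = ⊥-elim (two-lost l₁ l₂)
    where
    two-lost : Lost t y₁ → Lost t y₂ → ⊥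
    two-lost (inj₁ refl) (inj₁ refl) = y₁≢y₂ refl
    two-lost (inj₁ refl) (inj₂ (_ , s₂)) = x-alone e₁ e₂ (λ y₂≡x → y₁≢y₂ (sym y₂≡x)) s₂
    two-lost (inj₂ (_ , s₁)) (inj₁ refl) = x-alone e₂ e₁ y₁≢y₂ s₁
    two-lost (inj₂ (t₁ , s₁@(t≢t₁ , e₁' , _))) (inj₂ (t₂ , s₂@(_ , e₂' , _))) with SameTriangle? t₁ t₂
    ... | no t₁≢t₂ = distinct-smaller e₁ e₂ y₁≢y₂ t₁≢t₂ s₁ s₂
    ... | yes t₁≡t₂ = t≢t₁ (two-edges⇒same {t} {t₁} e₁ e₂ y₁≢y₂ e₁'
                             (subst (λ s → EdgeOf s y₂) (sym (same⇒≡ {t₁} {t₂} t₁≡t₂)) e₂'))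

  module Pairing (admissible : Admissible) where
    open Admissible admissible

    -- Two distinct edges of t, neither of them lost; every triangle has
    -- such a pair since at most one of its edges is lost.
    GoodPair : Triangle H → EdgeRep n × EdgeRep n → Set
    GoodPair t (p , q) = EdgeOf t p × EdgeOf t q × ¬ Lost t p × ¬ Lost t q × p ≢ q

    goodPair : (t : Triangle H) → Σ (EdgeRep n × EdgeRep n) (GoodPair t)
    goodPair t with Lost? t (a t , b t) | Lost? t (b t , c t)
    ... | yes ab-lost | _ =
      ((b t , c t) , (a t , c t)) , inj₂ (inj₁ refl) , inj₂ (inj₂ refl) ,
      (λ bc-lost → ab≢bc t (one-lost (inj₁ refl) (inj₂ (inj₁ refl)) ab-lost bc-lost)) ,
      (λ ac-lost → ab≢ac t (one-lost (inj₁ refl) (inj₂ (inj₂ refl)) ab-lost ac-lost)) , bc≢ac t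
    ... | no ab-kept | yes bc-lost =
      ((a t , b t) , (a t , c t)) , inj₁ refl , inj₂ (inj₂ refl) , ab-kept ,
      (λ ac-lost → bc≢ac t (one-lost (inj₂ (inj₁ refl)) (inj₂ (inj₂ refl)) bc-lost ac-lost)) , ab≢ac t
    ... | no ab-kept | no bc-kept =
      ((a t , b t) , (b t , c t)) , inj₁ refl , inj₂ (inj₁ refl) , ab-kept , bc-kept , ab≢bc t

    pair : Triangle H → EdgeRep n × EdgeRep n
    pair t = proj₁ (goodPair t)

    PairOf : Triangle H → EdgeRep n → EdgeRep n → Set
    PairOf t p q = pair t ≡ (p , q) ⊎ pair t ≡ (q , p)

    Paired : EdgeRep n → EdgeRep n → Set
    Paired p q = ∃ λ t → PairOf t p q

    pairOf-kept : ∀ {t p q} → PairOf t p q → EdgeOf t p × ¬ Lost t p × p ≢ q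
    pairOf-kept {t} (inj₁ eq) with goodPair t
    pairOf-kept (inj₁ refl) | _ , (ep , _ , p-kept , _ , p≢q) = ep , p-kept , p≢q
    pairOf-kept {t} (inj₂ eq) with goodPair t
    pairOf-kept (inj₂ refl) | _ , (_ , eq , _ , q-kept , q≢p) = eq , q-kept , λ p≡q → q≢p (sym p≡q)

    partner-unique : ∀ {t p q q'} → PairOf t p q → PairOf t p q' → q ≡ q'
    partner-unique (inj₁ r) (inj₁ r') = cong proj₂ (trans (sym r) r')
    partner-unique (inj₁ r) (inj₂ r') =
      let eq = trans (sym r) r' in trans (cong proj₂ eq) (cong proj₁ eq)
    partner-unique (inj₂ r) (inj₁ r') =
      let eq = trans (sym r) r' in trans (cong proj₁ eq) (cong proj₂ eq)
    partner-unique (inj₂ r) (inj₂ r') = cong proj₁ (trans (sym r) r')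

    kept-owner : ∀ {t t' y} → EdgeOf t y → ¬ Lost t y → EdgeOf t' y → ¬ Lost t' y → t ≡ t'
    kept-owner {t} {t'} e kept e' kept' with SameTriangle? t t'
    ... | yes same = same⇒≡ same
    ... | no t≢t' with ℕP.<-cmp (key t) (key t')
    ...   | tri< lt _ _ =
      ⊥-elim (kept' (inj₂ (t , (λ s → t≢t' (SameTriangle-sym {t'} {t} s)) , e , lt)))
    ...   | tri≈ _ eq _ = ⊥-elim (separates t≢t' e e' eq)
    ...   | tri> _ _ gt = ⊥-elim (kept (inj₂ (t' , t≢t' , e' , gt)))

    -- The pairs form a set of disjoint pairs: since kept edges have a
    -- unique owner, the partner of an edge is unique.
    Paired-sym : ∀ {p q} → Paired p q → Paired q p
    Paired-sym (t , inj₁ eq) = t , inj₂ eq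
    Paired-sym (t , inj₂ eq) = t , inj₁ eq

    Paired-irreflexive : ∀ {p q} → Paired p q → p ≢ q
    Paired-irreflexive (t , pq) = proj₂ (proj₂ (pairOf-kept {t} pq))

    Paired-functional : ∀ {p q q'} → Paired p q → Paired p q' → q ≡ q'
    Paired-functional {p} {q} {q'} (t , pq) (t' , pq')
      with pairOf-kept {t} pq | pairOf-kept {t'} pq'
    ... | e , kept , _ | e' , kept' , _ =
      partner-unique {t} pq
        (subst (λ s → PairOf s p q') (sym (kept-owner {t} {t'} e kept e' kept')) pq')

    partner? : ∀ p → Dec (∃ (Paired p))
    partner? p with anyTriangle? (λ t → p ≡ proj₁ (pair t) ⊎ p ≡ proj₂ (pair t))
                                 (λ t → (p ≟E proj₁ (pair t)) ⊎-dec (p ≟E proj₂ (pair t)))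
    ... | yes (t , inj₁ refl) = yes (proj₂ (pair t) , t , inj₁ refl)
    ... | yes (t , inj₂ refl) = yes (proj₁ (pair t) , t , inj₂ refl)
    ... | no none = no λ { (q , t , inj₁ eq) → none (t , inj₁ (cong proj₁ (sym eq)))
                         ; (q , t , inj₂ eq) → none (t , inj₂ (cong proj₂ (sym eq))) }

    Paired⇒edge : ∀ {p q} → Paired p q → ∃ λ t → EdgeOf t p
    Paired⇒edge (t , pq) = t , proj₁ (pairOf-kept {t} pq)

    Paired⇒≢x : ∀ {p q} → Paired p q → p ≢ x
    Paired⇒≢x (t , pq) p≡x = proj₁ (proj₂ (pairOf-kept {t} pq)) (inj₁ p≡x)

    covers : ∀ t → ∃ λ p → ∃ λ q → EdgeOf t p × EdgeOf t q × Paired p q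
    covers t =
      _ , _ , proj₁ (proj₂ (goodPair t)) , proj₁ (proj₂ (proj₂ (goodPair t))) , t , inj₁ refl

Next : ℕ → ℕ → Set
Next a b = suc a ≡ b ⊎ suc b ≡ a

∣suc-∣≢ : ∀ m i → ∣ m - i ∣ ≢ ∣ suc m - i ∣
∣suc-∣≢ zero (suc i) eq = ℕP.<-irrefl (sym eq) (ℕP.n<1+n i)
∣suc-∣≢ (suc m) (suc i) eq = ∣suc-∣≢ m i eq

Next⇒dist≢ : ∀ {a b} i → Next a b → ∣ a - i ∣ ≢ ∣ b - i ∣
Next⇒dist≢ {a} i (inj₁ refl) = ∣suc-∣≢ a i
Next⇒dist≢ {b = b} i (inj₂ refl) eq = ∣suc-∣≢ b i (sym eq)

Next⇒dist1 : ∀ {i a} → Next i a → ∣ a - i ∣ ≡ 1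
Next⇒dist1 {i} (inj₁ refl) = after i
  where
  after : ∀ m → ∣ suc m - m ∣ ≡ 1
  after zero = refl
  after (suc m) = after m
Next⇒dist1 {a = a} (inj₂ refl) = before a
  where
  before : ∀ m → ∣ m - suc m ∣ ≡ 1
  before zero = refl
  before (suc m) = before m

closer-up : ∀ a i → ∣ suc a - i ∣ ℕ.< ∣ a - i ∣ → a ℕ.< i
closer-up zero zero ()
closer-up (suc a) zero lt = ⊥-elim (ℕP.<-asym lt (ℕP.n<1+n (suc a)))
closer-up zero (suc i) _ = s≤s z≤n
closer-up (suc a) (suc i) lt = s≤s (closer-up a i lt)

closer-down : ∀ b i → ∣ b - i ∣ ℕ.< ∣ suc b - i ∣ → i ℕ.≤ b
closer-down b zero _ = z≤n
closer-down zero (suc i) lt = ⊥-elim (ℕP.<-asym lt (ℕP.n<1+n i))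
closer-down (suc b) (suc i) lt = s≤s (closer-down b i lt)

one-closer-neighbour : ∀ {m a₁ a₂} i → Next m a₁ → Next m a₂ →
  ∣ a₁ - i ∣ ℕ.< ∣ m - i ∣ → ∣ a₂ - i ∣ ℕ.< ∣ m - i ∣ → a₁ ≡ a₂
one-closer-neighbour i (inj₁ refl) (inj₁ refl) _ _ = refl
one-closer-neighbour i (inj₂ refl) (inj₂ refl) _ _ = refl
one-closer-neighbour {m} {a₂ = a₂} i (inj₁ refl) (inj₂ refl) l₁ l₂ =
  ⊥-elim (ℕP.<-asym (closer-up m i l₁) (ℕP.≤-<-trans (closer-down a₂ i l₂) (ℕP.n<1+n a₂)))
one-closer-neighbour {m} {a₁} i (inj₂ refl) (inj₁ refl) l₁ l₂ =
  ⊥-elim (ℕP.<-asym (closer-up m i l₂) (ℕP.≤-<-trans (closer-down a₁ i l₁) (ℕP.n<1+n a₁)))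

-- The path case: if T_H embeds in a path, rank the triangles by the
-- distance of their position from the position of a triangle containing x.
module PathKey {n : ℕ} (H : Graph n) (x : EdgeRep n) (k : ℕ) (f : Triangle H → Fin k)
  (f-injective : ∀ t t' → f t ≡ f t' → SameTriangle t t')
  (f-adjacent : ∀ t t' → TAdj t t' → PathAdj k (f t) (f t')) where
  open Triangles H

  centre : ℕ
  centre with anyTriangle? (λ t → EdgeOf t x) (λ t → EdgeOf? t x)
  ... | yes (t , _) = toℕ (f t)
  ... | no _ = 0

  centre-spec : ∀ {t} → EdgeOf t x → ∃ λ tₓ → EdgeOf tₓ x × centre ≡ toℕ (f tₓ)
  centre-spec {t} ex with anyTriangle? (λ t → EdgeOf t x) (λ t → EdgeOf? t x)
  ... | yes (tₓ , e) = tₓ , e , refl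
  ... | no none = ⊥-elim (none (t , ex))

  key : Triangle H → ℕ
  key t = ∣ toℕ (f t) - centre ∣

  open KeyPairing H x key

  next-positions : ∀ {t t'} → Neighbours t t' → Next (toℕ (f t)) (toℕ (f t'))
  next-positions {t} {t'} nb = f-adjacent t t' (Neighbours⇒TAdj nb)

  -- A triangle containing x has key 0 or 1, and only the triangle at the
  -- centre has key 0; so no triangle sharing another edge with it is smaller.
  x-alone : ∀ {t t' y} → EdgeOf t x → EdgeOf t y → y ≢ x → SmallerVia t y t' → ⊥
  x-alone {t} {t'} {y} ex ey y≢x (t≢t' , e' , lt) with centre-spec {t} ex
  ... | tₓ , exₓ , centre≡ with SameTriangle? t tₓ
  ...   | yes t≡tₓ = ℕP.n≮0 (subst (key t' ℕ.<_) key-t≡0 lt)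
    where
    key-t≡0 : key t ≡ 0
    key-t≡0 = trans (cong (λ s → ∣ toℕ (f s) - centre ∣) (same⇒≡ {t} {tₓ} t≡tₓ))
                    (trans (cong (∣ toℕ (f tₓ) -_∣) centre≡) (ℕP.∣n-n∣≡0 (toℕ (f tₓ))))
  ...   | no t≢tₓ =
    t≢tₓ (two-edges⇒same {t} {tₓ} ey ex y≢x (subst (λ s → EdgeOf s y) t'≡tₓ e') exₓ)
    where
    key-t≡1 : key t ≡ 1
    key-t≡1 = trans (cong (∣ toℕ (f t) -_∣) centre≡)
                    (Next⇒dist1 (next-positions (neighbours (λ s → t≢tₓ (SameTriangle-sym {tₓ} {t} s))
                                                            (x , exₓ , ex))))
    key-t'≡0 : key t' ≡ 0
    key-t'≡0 with key t' | subst (key t' ℕ.<_) key-t≡1 lt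
    ... | .0 | s≤s z≤n = refl
    t'≡tₓ : t' ≡ tₓ
    t'≡tₓ = same⇒≡ (f-injective t' tₓ (toℕ-injective (trans (ℕP.∣m-n∣≡0⇒m≡n key-t'≡0) centre≡)))

  -- Neighbouring positions have different distances from the centre.
  admissible : Admissible
  admissible = record
    { separates = λ t≢t' e e' → Next⇒dist≢ centre (next-positions (neighbours t≢t' (_ , e , e')))
    ; one-lost = one-lost-criterion x-alone distinct-smaller }
    where
    -- Two smaller triangles would sit at the two positions next to that of
    -- t, but only one of these is closer to the centre.
    distinct-smaller : ∀ {t t₁ t₂ y₁ y₂} → EdgeOf t y₁ → EdgeOf t y₂ → y₁ ≢ y₂ →
      ¬ SameTriangle t₁ t₂ → SmallerVia t y₁ t₁ → SmallerVia t y₂ t₂ → ⊥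
    distinct-smaller {t} {t₁} {t₂} e₁ e₂ _ t₁≢t₂ s₁@(_ , _ , lt₁) s₂@(_ , _ , lt₂) =
      t₁≢t₂ (f-injective t₁ t₂ (toℕ-injective
        (one-closer-neighbour centre (next-positions (smaller⇒neighbours e₁ s₁))
                                     (next-positions (smaller⇒neighbours e₂ s₂)) lt₁ lt₂)))

-- If t meets t₁
-- and t₂ in two different edges and t₁, t₂ share an edge, then the
-- vertices are w, w', α, β with t = ww'α, t₁ = ww'β, t₂ = wαβ, and w'αβ is a
-- fourth triangle neighbouring all three: the triangles of a K₄.
module K4Completion {n : ℕ} (H : Graph n) where
  open Triangles H

  OneOf : Fin n → Fin n → Fin n → Fin n → Set
  OneOf u v w z = z ≡ u ⊎ z ≡ v ⊎ z ≡ w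

  record Spans (t : Triangle H) (u v w : Fin n) : Set where
    constructor spans
    field
      u∈ : u ∈▵ t
      v∈ : v ∈▵ t
      w∈ : w ∈▵ t
      only : ∀ z → z ∈▵ t → OneOf u v w z
  open Spans

  spans-self : (t : Triangle H) → Spans t (a t) (b t) (c t)
  spans-self t = spans (inj₁ refl) (inj₂ (inj₁ refl)) (inj₂ (inj₂ refl)) (λ _ m → m)

  swap : ∀ {t u v w} → Spans t u v w → Spans t v u w
  swap (spans u∈ v∈ w∈ only) = spans v∈ u∈ w∈ λ z m → flip (only z m)
    where
    flip : ∀ {u v w z} → OneOf u v w z → OneOf v u w z
    flip (inj₁ eq) = inj₂ (inj₁ eq)
    flip (inj₂ (inj₁ eq)) = inj₁ eq
    flip (inj₂ (inj₂ eq)) = inj₂ (inj₂ eq)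

  rotate : ∀ {t u v w} → Spans t u v w → Spans t v w u
  rotate (spans u∈ v∈ w∈ only) = spans v∈ w∈ u∈ λ z m → turn (only z m)
    where
    turn : ∀ {u v w z} → OneOf u v w z → OneOf v w u z
    turn (inj₁ eq) = inj₂ (inj₂ eq)
    turn (inj₂ (inj₁ eq)) = inj₁ eq
    turn (inj₂ (inj₂ eq)) = inj₂ (inj₁ eq)

  Adj-sym : ∀ {u v} → Adj H u v → Adj H v u
  Adj-sym {u} {v} uv = subst T (adj-sym H u v) uv

  edge-adjacent : ∀ {t u v} → EdgeOf t (u , v) → Adj H u v
  edge-adjacent {t} (inj₁ refl) = ab t
  edge-adjacent {t} (inj₂ (inj₁ refl)) = bc t
  edge-adjacent {t} (inj₂ (inj₂ refl)) = ac t

  vertices-adjacent : ∀ {t : Triangle H} {u v} → u ∈▵ t → v ∈▵ t → u ≢ v → Adj H u v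
  vertices-adjacent {t} {u} {v} m m' u≢v with <-cmp u v
  ... | tri< u<v _ _ = edge-adjacent {t} (vertices⇒edge {t} m m' u<v)
  ... | tri≈ _ u≡v _ = ⊥-elim (u≢v u≡v)
  ... | tri> _ _ v<u = Adj-sym (edge-adjacent {t} (vertices⇒edge {t} m' m v<u))

  sorted-triangle : ∀ {x y z} → x < y → y < z → Adj H x y → Adj H y z → Adj H x z →
                    Σ (Triangle H) λ t → Spans t x y z
  sorted-triangle x<y y<z xy yz xz = _ , spans-self (tri _ _ _ x<y y<z xy yz xz)

  reorder : ∀ {x y z u v w} → (∀ {t} → Spans t x y z → Spans t u v w) →
            Σ (Triangle H) (λ t → Spans t x y z) → Σ (Triangle H) (λ t → Spans t u v w)
  reorder f (t , s) = t , f s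

  spanning-triangle : ∀ {u v w} → u ≢ v → v ≢ w → u ≢ w →
                      Adj H u v → Adj H v w → Adj H u w → Σ (Triangle H) λ t → Spans t u v w
  spanning-triangle {u} {v} {w} u≢v v≢w u≢w uv vw uw with <-cmp u v | <-cmp v w | <-cmp u w
  ... | tri≈ _ u≡v _ | _ | _ = ⊥-elim (u≢v u≡v)
  ... | _ | tri≈ _ v≡w _ | _ = ⊥-elim (v≢w v≡w)
  ... | _ | _ | tri≈ _ u≡w _ = ⊥-elim (u≢w u≡w)
  ... | tri< u<v _ _ | tri< v<w _ _ | _ = sorted-triangle u<v v<w uv vw uw
  ... | tri< _ _ _ | tri> _ _ w<v | tri< u<w _ _ =
    reorder (λ s → rotate (swap s)) (sorted-triangle u<w w<v uw (Adj-sym vw) uv)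
  ... | tri< u<v _ _ | tri> _ _ _ | tri> _ _ w<u =
    reorder rotate (sorted-triangle w<u u<v (Adj-sym uw) uv (Adj-sym vw))
  ... | tri> _ _ v<u | tri< _ _ _ | tri< u<w _ _ =
    reorder swap (sorted-triangle v<u u<w (Adj-sym uv) uw vw)
  ... | tri> _ _ _ | tri< v<w _ _ | tri> _ _ w<u =
    reorder (λ s → rotate (rotate s)) (sorted-triangle v<w w<u vw (Adj-sym uw) (Adj-sym uv))
  ... | tri> _ _ v<u | tri> _ _ w<v | _ =
    reorder (λ s → swap (rotate s)) (sorted-triangle w<v v<u (Adj-sym vw) (Adj-sym uv) (Adj-sym uw))

  opposite : ∀ {t y} → EdgeOf t y →
             ∃ λ w → Spans t (proj₁ y) (proj₂ y) w × w ≢ proj₁ y × w ≢ proj₂ y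
  opposite {t} (inj₁ refl) =
    c t , spans-self t , (λ c≡a → <-irrefl (sym c≡a) (a<c t)) , (λ c≡b → <-irrefl (sym c≡b) (b<c t))
  opposite {t} (inj₂ (inj₁ refl)) =
    a t , rotate (spans-self t) , (λ a≡b → <-irrefl a≡b (a<b t)) , (λ a≡c → <-irrefl a≡c (a<c t))
  opposite {t} (inj₂ (inj₂ refl)) =
    b t , rotate (swap (spans-self t)) ,
    (λ b≡a → <-irrefl (sym b≡a) (a<b t)) , (λ b≡c → <-irrefl b≡c (b<c t))

  common-edge : ∀ {s s' z₁ z₂} → z₁ ∈▵ s → z₂ ∈▵ s → z₁ ∈▵ s' → z₂ ∈▵ s' → z₁ ≢ z₂ →
                ∃ λ y → EdgeOf s y × EdgeOf s' y
  common-edge {s} {s'} {z₁} {z₂} m₁ m₂ m₁' m₂' z₁≢z₂ with <-cmp z₁ z₂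
  ... | tri< lt _ _ = _ , vertices⇒edge {s} m₁ m₂ lt , vertices⇒edge {s'} m₁' m₂' lt
  ... | tri≈ _ eq _ = ⊥-elim (z₁≢z₂ eq)
  ... | tri> _ _ gt = _ , vertices⇒edge {s} m₂ m₁ gt , vertices⇒edge {s'} m₂' m₁' gt

  subset⇒same : ∀ {t t' : Triangle H} → (∀ z → z ∈▵ t → z ∈▵ t') → SameTriangle t t'
  subset⇒same {t} {t'} ⊆ =
    vertices⇒same {t} {t'} (⊆ _ (inj₁ refl)) (⊆ _ (inj₂ (inj₁ refl))) (⊆ _ (inj₂ (inj₂ refl)))

  same-∈▵ : ∀ {t t' : Triangle H} {z} → SameTriangle t t' → z ∈▵ t → z ∈▵ t'
  same-∈▵ (p , _ , _) (inj₁ refl) = inj₁ p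
  same-∈▵ (_ , q , _) (inj₂ (inj₁ refl)) = inj₂ (inj₁ q)
  same-∈▵ (_ , _ , r) (inj₂ (inj₂ refl)) = inj₂ (inj₂ r)

  apex-outside : ∀ {t t' u v w w'} → Spans t u v w → Spans t' u v w' → w ≢ u → w ≢ v →
                 ¬ SameTriangle t t' → ¬ (w ∈▵ t')
  apex-outside {t} {t'} {u} {v} {w} S S' w≢u w≢v t≢t' m with only S' w m
  ... | inj₁ w≡u = w≢u w≡u
  ... | inj₂ (inj₁ w≡v) = w≢v w≡v
  ... | inj₂ (inj₂ refl) = t≢t' (subset⇒same {t} {t'} λ z m' → in-t' (only S z m'))
    where
    in-t' : ∀ {z} → OneOf u v w z → z ∈▵ t'
    in-t' (inj₁ refl) = u∈ S'
    in-t' (inj₂ (inj₁ refl)) = v∈ S'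
    in-t' (inj₂ (inj₂ refl)) = w∈ S'

  -- The completion with named vertices: t = ww'α, t₁ = ww'β, t₂ = wαγ.
  -- Since t₁ ≠ t and t₂ ≠ t, α ∉ t₁ and w' ∉ t₂, so the edge shared by t₁
  -- and t₂ is wβ = wγ; then w'αβ neighbours t (along w'α), t₁ (along w'β)
  -- and t₂ (along αβ).
  completion : ∀ {t t₁ t₂ w w' α β γ} → Spans t w w' α → Spans t₁ w w' β → Spans t₂ w α γ →
    w ≢ w' → α ≢ w → α ≢ w' → β ≢ w → β ≢ w' →
    ¬ SameTriangle t t₁ → ¬ SameTriangle t t₂ → (∃ λ y → EdgeOf t₁ y × EdgeOf t₂ y) →
    ∃ λ t₄ → Neighbours t₄ t × Neighbours t₄ t₁ × Neighbours t₄ t₂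
  completion {t} {t₁} {t₂} {w} {w'} {α} {β} {γ} S S₁ S₂ w≢w' α≢w α≢w' β≢w β≢w' t≢t₁ t≢t₂
             (_ , e₁ , e₂) =
    t₄ , neighbours t₄≢t (common-edge {t₄} {t} (u∈ S₄) (v∈ S₄) (v∈ S) (w∈ S) w'≢α) ,
         neighbours t₄≢t₁ (common-edge {t₄} {t₁} (u∈ S₄) (w∈ S₄) (v∈ S₁) (w∈ S₁) w'≢β) ,
         neighbours t₄≢t₂ (common-edge {t₄} {t₂} (v∈ S₄) (w∈ S₄) (v∈ S₂) β∈t₂ α≢β)
    where
    w'≢α : w' ≢ α
    w'≢α e = α≢w' (sym e)
    w'≢β : w' ≢ β
    w'≢β e = β≢w' (sym e)
    α∉t₁ : ¬ (α ∈▵ t₁)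
    α∉t₁ = apex-outside S S₁ α≢w α≢w' t≢t₁
    w'∉t₂ : ¬ (w' ∈▵ t₂)
    w'∉t₂ = apex-outside (swap (rotate (rotate S))) S₂ (λ e → w≢w' (sym e)) w'≢α t≢t₂
    β∉t : ¬ (β ∈▵ t)
    β∉t = apex-outside S₁ S β≢w β≢w' (λ s → t≢t₁ (SameTriangle-sym {t₁} {t} s))
    common : ∀ {z} → z ∈▵ t₁ → z ∈▵ t₂ → z ≡ w ⊎ β ≡ γ
    common {z} m m' with only S₁ z m
    ... | inj₁ z≡w = inj₁ z≡w
    ... | inj₂ (inj₁ refl) = ⊥-elim (w'∉t₂ m')
    ... | inj₂ (inj₂ refl) with only S₂ z m'
    ...   | inj₁ z≡w = inj₁ z≡w
    ...   | inj₂ (inj₁ refl) = ⊥-elim (α∉t₁ m)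
    ...   | inj₂ (inj₂ β≡γ) = inj₂ β≡γ
    β≡γ : β ≡ γ
    β≡γ with edge-ends {t₁} e₁ | edge-ends {t₂} e₂
    ... | (u₁ , v₁ , u<v) | (u₂ , v₂ , _) with common u₁ u₂ | common v₁ v₂
    ...   | inj₂ eq | _ = eq
    ...   | inj₁ _ | inj₂ eq = eq
    ...   | inj₁ u≡w | inj₁ v≡w = ⊥-elim (<-irrefl (trans u≡w (sym v≡w)) u<v)
    β∈t₂ : β ∈▵ t₂
    β∈t₂ = subst (_∈▵ t₂) (sym β≡γ) (w∈ S₂)
    α≢β : α ≢ β
    α≢β α≡β = α∉t₁ (subst (_∈▵ t₁) (sym α≡β) (w∈ S₁))
    fourth : Σ (Triangle H) λ t₄ → Spans t₄ w' α β
    fourth = spanning-triangle w'≢α α≢β w'≢β (vertices-adjacent {t} (v∈ S) (w∈ S) w'≢α)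
               (vertices-adjacent {t₂} (v∈ S₂) β∈t₂ α≢β) (vertices-adjacent {t₁} (v∈ S₁) (w∈ S₁) w'≢β)
    t₄ : Triangle H
    t₄ = proj₁ fourth
    S₄ : Spans t₄ w' α β
    S₄ = proj₂ fourth
    t₄≢t : ¬ SameTriangle t₄ t
    t₄≢t s = β∉t (same-∈▵ {t₄} {t} s (w∈ S₄))
    t₄≢t₁ : ¬ SameTriangle t₄ t₁
    t₄≢t₁ s = α∉t₁ (same-∈▵ {t₄} {t₁} s (v∈ S₄))
    t₄≢t₂ : ¬ SameTriangle t₄ t₂
    t₄≢t₂ s = w'∉t₂ (same-∈▵ {t₄} {t₂} s (u∈ S₄))

  -- The completion in terms of edges: t meets t₁ in y₁ and t₂ in y₂ ≠ y₁.
  -- The edges y₁ and y₂ of t share one vertex w, which gives the naming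
  -- of the vertices used above.
  K4-completion : ∀ {t t₁ t₂ u v p q} → EdgeOf t (u , v) → EdgeOf t₁ (u , v) →
    EdgeOf t (p , q) → EdgeOf t₂ (p , q) → (u , v) ≢ (p , q) →
    ¬ SameTriangle t t₁ → ¬ SameTriangle t t₂ → (∃ λ y → EdgeOf t₁ y × EdgeOf t₂ y) →
    ∃ λ t₄ → Neighbours t₄ t × Neighbours t₄ t₁ × Neighbours t₄ t₂
  K4-completion {t} {t₁} {t₂} {u} {v} {p} {q} e₁ e₁' e₂ e₂' y₁≢y₂ t≢t₁ t≢t₂ t₁t₂
    with opposite {t} e₁ | opposite {t₁} e₁' | opposite {t₂} e₂' | edge-ends {t} e₁ | edge-ends {t} e₂
  ... | (α , S , α≢u , α≢v) | (β , S₁ , β≢u , β≢v) | (_ , S₂ , _) | (_ , _ , u<v) | (p∈ , q∈ , p<q)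
    with only S p p∈ | only S q q∈
  ... | inj₁ refl | inj₁ refl = ⊥-elim (<-irrefl refl p<q)
  ... | inj₁ refl | inj₂ (inj₁ refl) = ⊥-elim (y₁≢y₂ refl)
  ... | inj₁ refl | inj₂ (inj₂ refl) =
    completion S S₁ S₂ (<⇒≢ u<v) α≢u α≢v β≢u β≢v t≢t₁ t≢t₂ t₁t₂
  ... | inj₂ (inj₁ refl) | inj₁ refl = ⊥-elim (<-asym u<v p<q)
  ... | inj₂ (inj₁ refl) | inj₂ (inj₁ refl) = ⊥-elim (<-irrefl refl p<q)
  ... | inj₂ (inj₁ refl) | inj₂ (inj₂ refl) =
    completion (swap S) (swap S₁) S₂ (λ v≡u → <⇒≢ u<v (sym v≡u)) α≢v α≢u β≢v β≢u t≢t₁ t≢t₂ t₁t₂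
  ... | inj₂ (inj₂ refl) | inj₁ refl =
    completion S S₁ (swap S₂) (<⇒≢ u<v) α≢u α≢v β≢u β≢v t≢t₁ t≢t₂ t₁t₂
  ... | inj₂ (inj₂ refl) | inj₂ (inj₁ refl) =
    completion (swap S) (swap S₁) (swap S₂) (λ v≡u → <⇒≢ u<v (sym v≡u)) α≢v α≢u β≢v β≢u
               t≢t₁ t≢t₂ t₁t₂
  ... | inj₂ (inj₂ refl) | inj₂ (inj₂ refl) = ⊥-elim (<-irrefl refl p<q)

-- The finite combinatorics of K₃⁺ (vertices 0, 1, 2 forming a triangle and
-- 3 pendant at 0).  A configuration records which of its four edges are
-- realised by neighbouring triangles and which positions are marked, i.e.
-- hold a triangle containing Maker's first edge.
record Config : Set where
  constructor config
  field
    r01 r02 r12 r03 : Bool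
    m0 m1 m2 m3 : Bool
open Config

pattern 0F = Fin.zero
pattern 1F = Fin.suc 0F
pattern 2F = Fin.suc 1F
pattern 3F = Fin.suc 2F

realised : Config → Fin 4 → Fin 4 → Bool
realised c 0F 1F = r01 c
realised c 1F 0F = r01 c
realised c 0F 2F = r02 c
realised c 2F 0F = r02 c
realised c 1F 2F = r12 c
realised c 2F 1F = r12 c
realised c 0F 3F = r03 c
realised c 3F 0F = r03 c
realised c _ _ = false

marked : Config → Fin 4 → Bool
marked c 0F = m0 c
marked c 1F = m1 c
marked c 2F = m2 c
marked c 3F = m3 c

full : Config
full = config true true true true false false false false

-- The ranking of positions: marked positions first, then their realised
-- neighbours, then the rest; ties are broken by larger realised degree
-- and finally by the position itself.
bit : Bool → ℕ
bit true = 1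
bit false = 0

degree : Config → Fin 4 → ℕ
degree c i =
  bit (realised c i 0F) + bit (realised c i 1F) + bit (realised c i 2F) + bit (realised c i 3F)

near-marked : Config → Fin 4 → Bool
near-marked c i = (realised c i 0F ∧ marked c 0F) ∨ (realised c i 1F ∧ marked c 1F) ∨
                  (realised c i 2F ∧ marked c 2F) ∨ (realised c i 3F ∧ marked c 3F)

distance : Config → Fin 4 → ℕ
distance c i = if marked c i then 0 else if near-marked c i then 1 else 2

rank : Config → Fin 4 → ℕ
rank c i = 16 * distance c i + 4 * (3 ∸ degree c i) + toℕ i

-- Triangles containing Maker's edge pairwise share it, so in the
-- configuration of a graph marked positions are pairwise realised.
Valid : Config → Set
Valid c = ∀ i j → T (marked c i) → T (marked c j) → i ≢ j → T (realised c i j)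

Fork : Config → Fin 4 → Fin 4 → Fin 4 → Set
Fork c p q₁ q₂ = q₁ ≢ q₂ × ¬ T (marked c p) × T (realised c p q₁) × T (realised c p q₂) ×
  ¬ T (realised c q₁ q₂) × rank c q₁ ℕ.< rank c p × rank c q₂ ℕ.< rank c p

-- Deciding statements about all configurations, to check them by evaluation.
∀-Bool? : ∀ {P : Bool → Set} → (∀ b → Dec (P b)) → Dec (∀ b → P b)
∀-Bool? P? with P? true | P? false
... | yes pt | yes pf = yes λ { true → pt ; false → pf }
... | no ¬pt | _ = no λ h → ¬pt (h true)
... | yes _ | no ¬pf = no λ h → ¬pf (h false)

∀-Config? : ∀ {P : Config → Set} → (∀ c → Dec (P c)) → Dec (∀ c → P c)
∀-Config? P? =
  map′ (λ h c → h (r01 c) (r02 c) (r12 c) (r03 c) (m0 c) (m1 c) (m2 c) (m3 c))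
       (λ h a b d e g k l o → h (config a b d e g k l o))
       (∀-Bool? λ a → ∀-Bool? λ b → ∀-Bool? λ d → ∀-Bool? λ e →
        ∀-Bool? λ g → ∀-Bool? λ k → ∀-Bool? λ l → ∀-Bool? λ o → P? (config a b d e g k l o))

valid? : ∀ c → Dec (Valid c)
valid? c = all? λ i → all? λ j →
  T? (marked c i) →-dec T? (marked c j) →-dec ¬? (i ≟ j) →-dec T? (realised c i j)

fork? : ∀ c p q₁ q₂ → Dec (Fork c p q₁ q₂)
fork? c p q₁ q₂ = ¬? (q₁ ≟ q₂) ×-dec ¬? (T? (marked c p)) ×-dec T? (realised c p q₁) ×-dec
  T? (realised c p q₂) ×-dec ¬? (T? (realised c q₁ q₂)) ×-dec
  (rank c q₁ ℕ.<? rank c p) ×-dec (rank c q₂ ℕ.<? rank c p)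

K3+Adj? : ∀ i j → Dec (K3+Adj i j)
K3+Adj? i j = edge? (toℕ i) (toℕ j) ⊎-dec edge? (toℕ j) (toℕ i)
  where
  edge? : ∀ x y →
    Dec (((x ≡ 0) × (y ≡ 1)) ⊎ ((x ≡ 0) × (y ≡ 2)) ⊎ ((x ≡ 1) × (y ≡ 2)) ⊎ ((x ≡ 0) × (y ≡ 3)))
  edge? x y = ((x ℕ.≟ 0) ×-dec (y ℕ.≟ 1)) ⊎-dec ((x ℕ.≟ 0) ×-dec (y ℕ.≟ 2)) ⊎-dec
              ((x ℕ.≟ 1) ×-dec (y ℕ.≟ 2)) ⊎-dec ((x ℕ.≟ 0) ×-dec (y ℕ.≟ 3))

-- The facts about K₃⁺ used below, each checked on all cases by evaluation:
-- the rank is injective (it is the position modulo 4), marked positions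
-- come first, valid configurations have no fork, every edge of K₃⁺ is
-- realised in the full configuration, and K₃⁺ has no K₄.
rank-injective : ∀ c i j → rank c i ≡ rank c j → i ≡ j
rank-injective = toWitness {a? = ∀-Config? λ c → all? λ i → all? λ j →
  (rank c i ℕ.≟ rank c j) →-dec (i ≟ j)} tt

marked-first : ∀ c p q → T (marked c p) → rank c q ℕ.< rank c p → T (marked c q)
marked-first = toWitness {a? = ∀-Config? λ c → all? λ p → all? λ q →
  T? (marked c p) →-dec (rank c q ℕ.<? rank c p) →-dec T? (marked c q)} tt

no-fork : ∀ c → Valid c → ∀ p q₁ q₂ → ¬ Fork c p q₁ q₂
no-fork = toWitness {a? = ∀-Config? λ c → valid? c →-dec
  (all? λ p → all? λ q₁ → all? λ q₂ → ¬? (fork? c p q₁ q₂))} tt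

K3+Adj⇒full : ∀ i j → K3+Adj i j → T (realised full i j)
K3+Adj⇒full = toWitness {a? = all? λ i → all? λ j → K3+Adj? i j →-dec T? (realised full i j)} tt

-- K₃⁺ has no four pairwise adjacent vertices (adjacency is irreflexive).
no-K4 : ∀ i j k l → K3+Adj i j → K3+Adj i k → K3+Adj i l → K3+Adj j k → K3+Adj j l → K3+Adj k l → ⊥
no-K4 = toWitness {a? = all? λ i → all? λ j → all? λ k → all? λ l →
  K3+Adj? i j →-dec K3+Adj? i k →-dec K3+Adj? i l →-dec K3+Adj? j k →-dec K3+Adj? j l →-dec
  K3+Adj? k l →-dec no λ ()} tt

-- The K₃⁺ case: rank each triangle by its position in the configuration of H.
module K3Key {n : ℕ} (H : Graph n) (x : EdgeRep n) (f : Triangle H → Fin 4)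
  (f-injective : ∀ t t' → f t ≡ f t' → SameTriangle t t')
  (f-adjacent : ∀ t t' → TAdj t t' → K3+Adj (f t) (f t')) where
  open Triangles H
  open K4Completion H

  ≡-at : ∀ {s t} → f s ≡ f t → s ≡ t
  ≡-at {s} {t} eq = same⇒≡ (f-injective s t eq)

  adjacent : ∀ {t t' : Triangle H} → Neighbours t t' → K3+Adj (f t) (f t')
  adjacent {t} {t'} nb = f-adjacent t t' (Neighbours⇒TAdj nb)

  RealisedAt : Fin 4 → Fin 4 → Set
  RealisedAt i j = ∃ λ t → ∃ λ t' → f t ≡ i × f t' ≡ j × Neighbours t t'

  realisedAt? : ∀ i j → Dec (RealisedAt i j)
  realisedAt? i j = anyTriangle? _ λ t → anyTriangle? _ λ t' →
    (f t ≟ i) ×-dec (f t' ≟ j) ×-dec Neighbours? t t'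

  RealisedAt-sym : ∀ {i j} → RealisedAt i j → RealisedAt j i
  RealisedAt-sym (t , t' , p , p' , nb) = t' , t , p' , p , Neighbours-sym nb

  MarkedAt : Fin 4 → Set
  MarkedAt i = ∃ λ t → f t ≡ i × EdgeOf t x

  markedAt? : ∀ i → Dec (MarkedAt i)
  markedAt? i = anyTriangle? _ λ t → (f t ≟ i) ×-dec EdgeOf? t x

  -- The configuration of H; kept opaque so that it is never evaluated.
  opaque
    config₀ : Config
    config₀ = config ⌊ realisedAt? 0F 1F ⌋ ⌊ realisedAt? 0F 2F ⌋
                     ⌊ realisedAt? 1F 2F ⌋ ⌊ realisedAt? 0F 3F ⌋
                     ⌊ markedAt? 0F ⌋ ⌊ markedAt? 1F ⌋ ⌊ markedAt? 2F ⌋ ⌊ markedAt? 3F ⌋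

    marked-config₀ : ∀ i → marked config₀ i ≡ ⌊ markedAt? i ⌋
    marked-config₀ 0F = refl
    marked-config₀ 1F = refl
    marked-config₀ 2F = refl
    marked-config₀ 3F = refl

    realised-config₀⁻ : ∀ i j → T (realised config₀ i j) → RealisedAt i j
    realised-config₀⁻ 0F 1F r = toWitness r
    realised-config₀⁻ 1F 0F r = RealisedAt-sym (toWitness r)
    realised-config₀⁻ 0F 2F r = toWitness r
    realised-config₀⁻ 2F 0F r = RealisedAt-sym (toWitness r)
    realised-config₀⁻ 1F 2F r = toWitness r
    realised-config₀⁻ 2F 1F r = RealisedAt-sym (toWitness r)
    realised-config₀⁻ 0F 3F r = toWitness r
    realised-config₀⁻ 3F 0F r = RealisedAt-sym (toWitness r)

    -- Only edges of K₃⁺ can be realised.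
    realised-config₀⁺ : ∀ i j → T (realised full i j) → RealisedAt i j → T (realised config₀ i j)
    realised-config₀⁺ 0F 1F _ r = fromWitness r
    realised-config₀⁺ 1F 0F _ r = fromWitness (RealisedAt-sym r)
    realised-config₀⁺ 0F 2F _ r = fromWitness r
    realised-config₀⁺ 2F 0F _ r = fromWitness (RealisedAt-sym r)
    realised-config₀⁺ 1F 2F _ r = fromWitness r
    realised-config₀⁺ 2F 1F _ r = fromWitness (RealisedAt-sym r)
    realised-config₀⁺ 0F 3F _ r = fromWitness r
    realised-config₀⁺ 3F 0F _ r = fromWitness (RealisedAt-sym r)

  marked⇒ : ∀ {t} → T (marked config₀ (f t)) → EdgeOf t x
  marked⇒ {t} m with toWitness {a? = markedAt? (f t)} (subst T (marked-config₀ (f t)) m)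
  ... | s , fs≡ft , ex = subst (λ r → EdgeOf r x) (≡-at fs≡ft) ex

  marked⇐ : ∀ {t} → EdgeOf t x → T (marked config₀ (f t))
  marked⇐ {t} ex = subst T (sym (marked-config₀ (f t))) (fromWitness (t , refl , ex))

  realised⇒ : ∀ {t t'} → T (realised config₀ (f t) (f t')) → Neighbours t t'
  realised⇒ {t} {t'} r with realised-config₀⁻ (f t) (f t') r
  ... | s , s' , fs≡ft , fs'≡ft' , nb with ≡-at {s} {t} fs≡ft | ≡-at {s'} {t'} fs'≡ft'
  ...   | refl | refl = nb

  realised⇐ : ∀ {t t'} → Neighbours t t' → T (realised config₀ (f t) (f t'))
  realised⇐ {t} {t'} nb =
    realised-config₀⁺ (f t) (f t') (K3+Adj⇒full (f t) (f t') (adjacent nb))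
                      (t , t' , refl , refl , nb)

  -- Triangles containing x are neighbours along x.
  valid₀ : Valid config₀
  valid₀ i j mi mj i≢j
    with toWitness {a? = markedAt? i} (subst T (marked-config₀ i) mi)
       | toWitness {a? = markedAt? j} (subst T (marked-config₀ j) mj)
  ... | s , refl , es | s' , refl , es' =
    realised⇐ (neighbours (λ same → i≢j (cong f (same⇒≡ same))) (x , es , es'))

  key : Triangle H → ℕ
  key t = rank config₀ (f t)

  open KeyPairing H x key

  -- A smaller triangle than one containing x is marked, so it contains x.
  x-alone : ∀ {t t' y} → EdgeOf t x → EdgeOf t y → y ≢ x → SmallerVia t y t' → ⊥
  x-alone {t} {t'} ex ey y≢x (t≢t' , e' , lt) =
    t≢t' (two-edges⇒same {t} {t'} ey ex y≢x e'
           (marked⇒ {t'} (marked-first config₀ (f t) (f t') (marked⇐ {t} ex) lt)))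

  no-four-neighbours : ∀ {t t₁ t₂ t₃} → Neighbours t t₁ → Neighbours t t₂ → Neighbours t t₃ →
                       Neighbours t₁ t₂ → Neighbours t₁ t₃ → Neighbours t₂ t₃ → ⊥
  no-four-neighbours n₀₁ n₀₂ n₀₃ n₁₂ n₁₃ n₂₃ =
    no-K4 _ _ _ _ (adjacent n₀₁) (adjacent n₀₂) (adjacent n₀₃)
                  (adjacent n₁₂) (adjacent n₁₃) (adjacent n₂₃)

  -- If t contains x, one of its two lost edges differs from x.  Otherwise
  -- the two smaller triangles are not neighbours (there is no fork in the
  -- ranking) or they are, and the three extend to a K₄ in T_H.
  distinct-smaller : ∀ {t t₁ t₂ y₁ y₂} → EdgeOf t y₁ → EdgeOf t y₂ → y₁ ≢ y₂ →
    ¬ SameTriangle t₁ t₂ → SmallerVia t y₁ t₁ → SmallerVia t y₂ t₂ → ⊥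
  distinct-smaller {t} {t₁} {t₂} {y₁} {y₂} e₁ e₂ y₁≢y₂ t₁≢t₂ s₁ s₂
    with EdgeOf? t x | Neighbours? t₁ t₂
  ... | yes ex | _ with y₁ ≟E x
  ...   | no y₁≢x = x-alone ex e₁ y₁≢x s₁
  ...   | yes refl = x-alone ex e₂ (λ y₂≡x → y₁≢y₂ (sym y₂≡x)) s₂
  distinct-smaller {t} {t₁} {t₂} e₁ e₂ _ t₁≢t₂ s₁@(_ , _ , lt₁) s₂@(_ , _ , lt₂) | no ¬ex | no ¬nb =
    no-fork config₀ valid₀ (f t) (f t₁) (f t₂)
      ((λ eq → t₁≢t₂ (f-injective t₁ t₂ eq)) , (λ m → ¬ex (marked⇒ {t} m)) ,
       realised⇐ (smaller⇒neighbours e₁ s₁) , realised⇐ (smaller⇒neighbours e₂ s₂) ,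
       (λ r → ¬nb (realised⇒ r)) , lt₁ , lt₂)
  distinct-smaller {t} {t₁} {t₂} e₁ e₂ y₁≢y₂ _ s₁@(t≢t₁ , e₁' , _) s₂@(t≢t₂ , e₂' , _)
    | no _ | yes nb₁₂
    with K4-completion {t} {t₁} {t₂} e₁ e₁' e₂ e₂' y₁≢y₂ t≢t₁ t≢t₂ (Neighbours.shared nb₁₂)
  ... | t₄ , nb₄ , nb₄₁ , nb₄₂ =
    no-four-neighbours (smaller⇒neighbours e₁ s₁) (smaller⇒neighbours e₂ s₂) (Neighbours-sym nb₄)
                       nb₁₂ (Neighbours-sym nb₄₁) (Neighbours-sym nb₄₂)

  admissible : Admissible
  admissible = record
    { separates = λ {t} {t'} t≢t' _ _ eq →
        t≢t' (f-injective t t' (rank-injective config₀ (f t) (f t') eq))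
    ; one-lost = one-lost-criterion x-alone distinct-smaller }

admissible-key : ∀ {n} (H : Graph n) (x : EdgeRep n) → VeryBasic H →
                 Σ (Triangle H → ℕ) (KeyPairing.Admissible H x)
admissible-key H x (inj₁ (f , f-injective , f-adjacent)) =
  _ , K3Key.admissible H x f f-injective f-adjacent
admissible-key H x (inj₂ (k , f , f-injective , f-adjacent)) =
  _ , PathKey.admissible H x k f f-injective f-adjacent

module EdgeList {n : ℕ} (G : Graph n) where

  edgeAt : Fin n → Fin n → List (EdgeRep n)
  edgeAt u v = if ⌊ u <? v ⌋ ∧ adj G u v then (u , v) ∷ [] else []

  edgesFrom : Fin n → List (EdgeRep n)
  edgesFrom u = concatMap (edgeAt u) (allFin n)

  ∈-edgeAt : ∀ u v {y} → y ∈ edgeAt u v → y ≡ (u , v)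
  ∈-edgeAt u v m with ⌊ u <? v ⌋ ∧ adj G u v
  ∈-edgeAt u v (here eq) | true = eq

  Unique-edgeAt : ∀ u v → Unique (edgeAt u v)
  Unique-edgeAt u v with ⌊ u <? v ⌋ ∧ adj G u v
  ... | true = [] ∷ []
  ... | false = []

  ∈-edgesFrom : ∀ u {y} → y ∈ edgesFrom u → proj₁ y ≡ u
  ∈-edgesFrom u m = first (∈-concatMap⁻ (edgeAt u) {xs = allFin n} m)
    where
    first : ∀ {vs y} → Any.Any (λ v → y ∈ edgeAt u v) vs → proj₁ y ≡ u
    first (here m) = cong proj₁ (∈-edgeAt u _ m)
    first (there m) = first m

  edgeList-unique : Unique (edgeList G)
  edgeList-unique = Unique-concatMap edgesFrom (allFin⁺ n)
    (λ u → Unique-concatMap (edgeAt u) (allFin⁺ n) (Unique-edgeAt u)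
             (λ {v} {v'} m m' → cong proj₂ (trans (sym (∈-edgeAt u v m)) (∈-edgeAt u v' m'))))
    (λ {u} {u'} m m' → trans (sym (∈-edgesFrom u m)) (∈-edgesFrom u' m'))

  edge∈edgeList : ∀ {y} → IsEdge G y → y ∈ edgeList G
  edge∈edgeList {u , v} (u<v , uv) =
    ∈-concatMap⁺ edgesFrom {xs = allFin n} (Any.map (λ { refl → in-edgesFrom }) (∈-allFin u))
    where
    in-edgeAt : (u , v) ∈ edgeAt u v
    in-edgeAt with u <? v
    ... | no u≮v = ⊥-elim (u≮v u<v)
    ... | yes _ with adj G u v
    ...   | true = here refl
    in-edgesFrom : (u , v) ∈ edgesFrom u
    in-edgesFrom =
      ∈-concatMap⁺ (edgeAt u) {xs = allFin n} (Any.map (λ { refl → in-edgeAt }) (∈-allFin v))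

module Deletion {n : ℕ} (G : Graph n) (e : EdgeRep n) (e₁<e₂ : proj₁ e < proj₂ e) where

  H : Graph n
  H = delete G e

  sameEdge-self : (u v : Fin n) → sameEdge (u , v) u v ≡ true
  sameEdge-self u v with u ≟ u | v ≟ v
  ... | yes _ | yes _ = refl
  ... | no u≢u | _ = ⊥-elim (u≢u refl)
  ... | yes _ | no v≢v = ⊥-elim (v≢v refl)

  sameEdge-other : ∀ {u v} → u < v → (u , v) ≢ e → sameEdge e u v ≡ false
  sameEdge-other {u} {v} u<v uv≢e with u ≟ proj₁ e | v ≟ proj₂ e | u ≟ proj₂ e | v ≟ proj₁ e
  ... | yes refl | yes refl | _ | _ = ⊥-elim (uv≢e refl)
  ... | _ | _ | yes refl | yes refl = ⊥-elim (<-asym u<v e₁<e₂)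
  ... | no _ | _ | no _ | _ = refl
  ... | no _ | _ | yes _ | no _ = refl
  ... | yes _ | no _ | no _ | _ = refl
  ... | yes _ | no _ | yes _ | no _ = refl

  kept-adj⁻ : ∀ {u v} → Adj H u v → Adj G u v × (u , v) ≢ e
  kept-adj⁻ {u} {v} uv with Equivalence.to T-∧ uv
  ... | uv-in-G , not-e = uv-in-G , λ { refl → subst (λ b → T (not b)) (sameEdge-self u v) not-e }

  kept-adj⁺ : ∀ {u v} → u < v → Adj G u v → (u , v) ≢ e → Adj H u v
  kept-adj⁺ u<v uv uv≢e =
    Equivalence.from T-∧ (uv , subst (λ b → T (not b)) (sym (sameEdge-other u<v uv≢e)) tt)

  open Triangles H

  edge-of-H : ∀ {t p} → EdgeOf t p → IsEdge G p × p ≢ e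
  edge-of-H {t} (inj₁ refl) = (a<b t , proj₁ (kept-adj⁻ (ab t))) , proj₂ (kept-adj⁻ (ab t))
  edge-of-H {t} (inj₂ (inj₁ refl)) = (b<c t , proj₁ (kept-adj⁻ (bc t))) , proj₂ (kept-adj⁻ (bc t))
  edge-of-H {t} (inj₂ (inj₂ refl)) = (a<c t , proj₁ (kept-adj⁻ (ac t))) , proj₂ (kept-adj⁻ (ac t))

  restrict : (t : Triangle G) → (a t , b t) ≢ e → (b t , c t) ≢ e → (a t , c t) ≢ e → Triangle H
  restrict t ab≢e bc≢e ac≢e =
    tri (a t) (b t) (c t) (a<b t) (b<c t) (kept-adj⁺ (a<b t) (ab t) ab≢e)
        (kept-adj⁺ (b<c t) (bc t) bc≢e) (kept-adj⁺ (<-trans (a<b t) (b<c t)) (ac t) ac≢e)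

module AfterFirstMove {n : ℕ} (G : Graph n) {z : EdgeRep n} (z∈E : z ∈ edgeList G)
  (e : EdgeRep n) (e-edge : IsEdge G e) (e≢z : e ≢ z) (very-basic : VeryBasic (delete G e)) where
  open EdgeList G
  open Deletion G e (proj₁ e-edge)
  open Triangles H
  open KeyPairing H z (proj₁ (admissible-key H z very-basic))
  open Pairing (proj₂ (admissible-key H z very-basic))

  -- A Maker set without e and without a whole pair contains no triangle:
  -- a triangle of G avoiding e is a triangle of H, which contains a pair.
  sufficient : ∀ M → e ∉ M → (∀ p q → Paired p q → p ∉ M ⊎ q ∉ M) → MakerHasNoTriangle G M
  sufficient M e∉M no-whole-pair t (ab∈M , bc∈M , ac∈M) = contains-pair (covers tH)
    where
    ≢e : ∀ {y} → y ∈ M → y ≢ e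
    ≢e y∈M refl = e∉M y∈M
    tH : Triangle H
    tH = restrict t (≢e ab∈M) (≢e bc∈M) (≢e ac∈M)
    ∈M : ∀ {y} → EdgeOf tH y → y ∈ M
    ∈M (inj₁ refl) = ab∈M
    ∈M (inj₂ (inj₁ refl)) = bc∈M
    ∈M (inj₂ (inj₂ refl)) = ac∈M
    contains-pair : (∃ λ p → ∃ λ q → EdgeOf tH p × EdgeOf tH q × Paired p q) → ⊥
    contains-pair (p , q , ep , eq , pq) =
      [ (λ p∉M → p∉M (∈M ep)) , (λ q∉M → q∉M (∈M eq)) ]′ (no-whole-pair p q pq)

  open PairingStrategy G e Paired Paired-sym Paired-functional Paired-irreflexive partner? sufficient

  e∈rest : e ∈ edgeList G ─ z∈E
  e∈rest = ∈-─⁺ z∈E (edge∈edgeList e-edge) e≢z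

  free : List (EdgeRep n)
  free = (edgeList G ─ z∈E) ─ e∈rest

  -- Every paired edge is an edge of G other than z and e, hence still free.
  paired-free : ∀ {p q} → Paired p q → p ∈ free
  paired-free pq with Paired⇒edge pq
  ... | t , ep = ∈-─⁺ e∈rest (∈-─⁺ z∈E (edge∈edgeList (proj₁ (edge-of-H {t} ep))) (Paired⇒≢x pq))
                           (proj₂ (edge-of-H {t} ep))

  start : Position (z ∷ []) free
  start = record
    { free-unique = Unique-─ e∈rest (Unique-─ z∈E edgeList-unique)
    ; free-unclaimed = λ { m (here refl) → ∉-─ z∈E edgeList-unique (∈-─⁻ e∈rest m) }
    ; e-owned = (λ { (here e≡z) → e≢z e≡z }) , ∉-─ e∈rest (Unique-─ z∈E edgeList-unique)
    ; pairs-safe = λ p q pq → inj₁ (paired-free pq , paired-free (Paired-sym pq)) }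

  answer : BreakerWinsBreakerTurn G (z ∷ []) (edgeList G ─ z∈E)
  answer = claim e∈rest (breaker-wins start)
    where
    claim : ∀ {M U w} (w∈U : w ∈ U) → BreakerWinsMakerTurn G M (U ─ w∈U) →
            BreakerWinsBreakerTurn G M U
    claim {U = _ ∷ _} w∈U wins = bmove w∈U wins

-- Basic graphs: whichever edge z Maker opens with, one of e₁ , e₂ differs
-- from z.
basic⇒breaker-wins : ∀ {n} (G : Graph n) → Basic G → BreakerWinsTriangleGame G
basic⇒breaker-wins G ((e₁ , e₁-edge) , (e₂ , e₂-edge) , e₁≢e₂ , basic₁ , basic₂) =
  maker-opens answer
  where
  answer : ∀ {z} (z∈E : z ∈ edgeList G) → BreakerWinsBreakerTurn G (z ∷ []) (edgeList G ─ z∈E)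
  answer {z} z∈E with e₁ ≟E z
  ... | no e₁≢z = AfterFirstMove.answer G z∈E e₁ e₁-edge e₁≢z basic₁
  ... | yes refl = AfterFirstMove.answer G z∈E e₂ e₂-edge (λ e₂≡e₁ → e₁≢e₂ (sym e₂≡e₁)) basic₂
  maker-opens : ∀ {U} → (∀ {z} (z∈U : z ∈ U) → BreakerWinsBreakerTurn G (z ∷ []) (U ─ z∈U)) →
                BreakerWinsMakerTurn G [] U
  maker-opens {[]} _ = mend λ _ ()
  maker-opens {_ ∷ _} answer = mmove answer

-- Corollary 17.
corollary17 : ∀ (n : ℕ) (G : Graph n) → NoIsolatedVertices G → Basic G →
    BreakerWinsTriangleGame G
corollary17 n G _ basic = basic⇒breaker-wins G basic
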